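{- A digraphical species $\mathcal F: \mathbf{elGr}^{\mathrm{op}}\to\mathbf{Set}$ is (the digraphical species of) a Petri net if and only if it is flat (meaning that, for all $m,n$, the action of $\mathfrak S_m \times \mathfrak S_n$ on the set $\mathcal F[\text{corolla with } m \text{ incoming and } n \text{ outgoing edges}]$ is free) and it takes finite values and has finite support (meaning that there is an upper bound on the $m$ and $n$ for which $\mathcal F[\text{corolla with } m \text{ incoming and } n \text{ outgoing edges}]$ is non-empty).
   Context: A (whole-grain) Petri net is a diagram of finite sets $S \leftarrow I \to T \leftarrow O \to S$; morphisms are etale maps (maps of such diagrams whose two middle squares are pullbacks). $\mathbf{elGr}$ is (a skeleton of) the category of elementary graphs — the unit graph $[\star]$ (one edge, no nodes) and, for $m,n\ge 0$, the corolla with one node, $m$ incoming and $n$ outgoing edges — and etale maps; its non-invertible maps are the $m+n$ edge inclusions of $[\star]$ into a corolla, and the automorphisms of that corolla form $\mathfrak S_m\times\mathfrak S_n$. A digraphical species is a presheaf on $\mathbf{elGr}$. A Petri net $\mathsf P$ is regarded as a digraphical species via the fully faithful functor $\mathsf P\mapsto \operatorname{Hom}(-,\mathsf P)$ restricted to elementary graphs; its value on $[\star]$ is $S$, and etale maps from the corolla with $m$ inputs and $n$ outputs correspond to a transition $t$ together with bijections of $\{1,\dots,m\}$ with the pre-set of $t$ and of $\{1,\dots,n\}$ with its post-set. The statement characterises the essential image of this embedding. -}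

module Defs where

open import Data.Nat using (ℕ; _≤_)
open import Data.Fin using (Fin)
open import Data.Vec using (Vec; lookup; tabulate)
open import Data.Vec.Properties using (lookup∘tabulate; tabulate∘lookup)
open import Data.Product using (Σ; ∃; _×_; _,_; proj₁; proj₂)
open import Data.Fin.Permutation as P using (Permutation′; _⟨$⟩ʳ_; _⟨$⟩ˡ_; _∘ₚ_)
open import Function using (_∘_)
open import Function.Bundles using (_↔_; Inverse)
open import Function.Definitions using (Injective)
open import Relation.Binary.PropositionalEquality
  using (_≡_; refl; sym; trans; cong)

-- Digraphical species = presheaves on elGr, written out explicitly.
--
-- elGr has objects: the unit graph ⋆ and corollas C(m,n).
-- Non-identity maps: the edge inclusions ι_in j : ⋆ → C(m,n) (j : Fin m),
-- ι_out k : ⋆ → C(m,n) (k : Fin n), and automorphisms (σ,τ) ∈ S_m × S_n of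
-- C(m,n), with (σ,τ) ∘ ι_in j = ι_in (σ j), (σ,τ) ∘ ι_out k = ι_out (τ k).
-- A presheaf F consists of
--   E      = F[⋆]
--   C m n  = F[C(m,n)]
--   act σ τ = F(σ,τ) : C m n → C m n          (contravariant functoriality)
--   src c j = F(ι_in j) c,  tgt c k = F(ι_out k) c.
-- A morphism of elGr is determined by its underlying map, so `act` only
-- depends on the permutations as functions (act-cong).

record Species : Set₁ where
  field
    E   : Set
    C   : ℕ → ℕ → Set
    act : ∀ {m n} → Permutation′ m → Permutation′ n → C m n → C m n
    act-cong : ∀ {m n} {σ σ′ : Permutation′ m} {τ τ′ : Permutation′ n} →
               σ P.≈ σ′ → τ P.≈ τ′ → (c : C m n) → act σ τ c ≡ act σ′ τ′ c
    act-id : ∀ {m n} (c : C m n) → act P.id P.id c ≡ c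
    -- F((σ,τ) ∘ (σ′,τ′)) = F(σ′,τ′) ∘ F(σ,τ); note σ ∘ σ′ = σ′ ∘ₚ σ
    act-∘ : ∀ {m n} (σ σ′ : Permutation′ m) (τ τ′ : Permutation′ n) (c : C m n) →
            act (σ′ ∘ₚ σ) (τ′ ∘ₚ τ) c ≡ act σ′ τ′ (act σ τ c)
    src : ∀ {m n} → C m n → Fin m → E
    tgt : ∀ {m n} → C m n → Fin n → E
    -- F(ι_in (σ j)) = F((σ,τ) ∘ ι_in j) = F(ι_in j) ∘ F(σ,τ)
    src-act : ∀ {m n} (σ : Permutation′ m) (τ : Permutation′ n) (c : C m n) (j : Fin m) →
              src (act σ τ c) j ≡ src c (σ ⟨$⟩ʳ j)
    tgt-act : ∀ {m n} (σ : Permutation′ m) (τ : Permutation′ n) (c : C m n) (k : Fin n) →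
              tgt (act σ τ c) k ≡ tgt c (τ ⟨$⟩ʳ k)

open Species public

record _≅_ (F G : Species) : Set where
  field
    isoE : E F ↔ E G
    isoC : ∀ m n → C F m n ↔ C G m n
    nat-act : ∀ {m n} (σ : Permutation′ m) (τ : Permutation′ n) (c : C F m n) →
              Inverse.to (isoC m n) (act F σ τ c) ≡ act G σ τ (Inverse.to (isoC m n) c)
    nat-src : ∀ {m n} (c : C F m n) (j : Fin m) →
              src G (Inverse.to (isoC m n) c) j ≡ Inverse.to isoE (src F c j)
    nat-tgt : ∀ {m n} (c : C F m n) (k : Fin n) →
              tgt G (Inverse.to (isoC m n) c) k ≡ Inverse.to isoE (tgt F c k)

Flat : Species → Set
Flat F = ∀ {m n} (σ : Permutation′ m) (τ : Permutation′ n) (c : C F m n) →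
         act F σ τ c ≡ c → (σ P.≈ P.id) × (τ P.≈ P.id)

Finite : Set → Set
Finite A = ∃ λ k → A ↔ Fin k

FiniteValues : Species → Set
FiniteValues F = Finite (E F) × (∀ m n → Finite (C F m n))

FiniteSupport : Species → Set
FiniteSupport F = ∃ λ N → ∀ m n → C F m n → (m ≤ N) × (n ≤ N)

-- Petri nets  S ← I → T ← O → S  with finite sets (skeletally: Fin k)

record PetriNet : Set where
  field
    nS nI nT nO : ℕ
    inS  : Fin nI → Fin nS
    inT  : Fin nI → Fin nT
    outT : Fin nO → Fin nT
    outS : Fin nO → Fin nS

IsEnum : ∀ {a k m} (p : Fin a → Fin k) (t : Fin k) (f : Fin m → Fin a) → Set
IsEnum p t f = (∀ j → p (f j) ≡ t) × Injective _≡_ _≡_ f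
             × (∀ x → p x ≡ t → ∃ λ j → f j ≡ x)

IsEnum-ext : ∀ {a k m} {p : Fin a → Fin k} {t : Fin k} {f g : Fin m → Fin a} →
             (∀ j → f j ≡ g j) → IsEnum p t f → IsEnum p t g
IsEnum-ext {p = p} e (over , inj , surj) =
  (λ j → trans (cong p (sym (e j))) (over j)) ,
  (λ {i} {j} q → inj (trans (e i) (trans q (sym (e j))))) ,
  (λ x px → let (j , fj) = surj x px in j , trans (sym (e j)) fj)

IsEnum-perm : ∀ {a k m} {p : Fin a → Fin k} {t : Fin k} {f : Fin m → Fin a} →
              (σ : Permutation′ m) → IsEnum p t f → IsEnum p t (f ∘ (σ ⟨$⟩ʳ_))
IsEnum-perm {f = f} σ (over , inj , surj) =
  (λ j → over (σ ⟨$⟩ʳ j)) ,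
  (λ {i} {j} q → trans (sym (P.inverseˡ σ)) (trans (cong (σ ⟨$⟩ˡ_) (inj q)) (P.inverseˡ σ))) ,
  (λ x px → let (j , fj) = surj x px in
     σ ⟨$⟩ˡ j , trans (cong f (P.inverseʳ σ)) fj)

module _ (N : PetriNet) where
  open PetriNet N

  -- an etale map C(m,n) → N: a transition t with bijections
  -- Fin m ≅ pre-set of t and Fin n ≅ post-set of t (stored as vectors)
  record Cor (m n : ℕ) : Set where
    constructor mkCor
    field
      tr   : Fin nT
      ins  : Vec (Fin nI) m
      outs : Vec (Fin nO) n
      .insOK  : IsEnum inT tr (lookup ins)
      .outsOK : IsEnum outT tr (lookup outs)
  open Cor

  private
    cor-≡ : ∀ {m n} {c c′ : Cor m n} → tr c ≡ tr c′ → ins c ≡ ins c′ → outs c ≡ outs c′ →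
            c ≡ c′
    cor-≡ {c = mkCor _ _ _ _ _} {mkCor _ _ _ _ _} refl refl refl = refl

    permV : ∀ {A : Set} {m} → Permutation′ m → Vec A m → Vec A m
    permV σ v = tabulate (λ j → lookup v (σ ⟨$⟩ʳ j))

    permV-ok : ∀ {a k m} {p : Fin a → Fin k} {t : Fin k} (σ : Permutation′ m)
               (v : Vec (Fin a) m) → IsEnum p t (lookup v) → IsEnum p t (lookup (permV σ v))
    permV-ok σ v ok = IsEnum-ext (λ j → sym (lookup∘tabulate _ j)) (IsEnum-perm σ ok)

    actP : ∀ {m n} → Permutation′ m → Permutation′ n → Cor m n → Cor m n
    actP σ τ (mkCor t i o a b) = mkCor t (permV σ i) (permV τ o) (permV-ok σ i a) (permV-ok τ o b)

    permV-cong : ∀ {A : Set} {m} {σ σ′ : Permutation′ m} → σ P.≈ σ′ → (v : Vec A m) →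
                 permV σ v ≡ permV σ′ v
    permV-cong {σ = σ} {σ′} e v = helper
      where
      open import Data.Vec.Properties using (tabulate-cong)
      helper : tabulate (λ j → lookup v (σ ⟨$⟩ʳ j)) ≡ tabulate (λ j → lookup v (σ′ ⟨$⟩ʳ j))
      helper = tabulate-cong (λ j → cong (lookup v) (e j))

    permV-∘ : ∀ {A : Set} {m} (σ σ′ : Permutation′ m) (v : Vec A m) →
              permV (σ′ ∘ₚ σ) v ≡ permV σ′ (permV σ v)
    permV-∘ σ σ′ v = tabulate-cong (λ j → sym (lookup∘tabulate _ (σ′ ⟨$⟩ʳ j)))
      where open import Data.Vec.Properties using (tabulate-cong)

  speciesOf : Species
  speciesOf = record
    { E = Fin nS
    ; C = Cor
    ; act = actP
    ; act-cong = λ { {σ = σ} {σ′} {τ} {τ′} e e′ (mkCor t i o a b) →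
        cor-≡ refl (permV-cong {σ = σ} {σ′} e i) (permV-cong {σ = τ} {τ′} e′ o) }
    ; act-id = λ { (mkCor t i o a b) → cor-≡ refl (tabulate∘lookup i) (tabulate∘lookup o) }
    ; act-∘ = λ { σ σ′ τ τ′ (mkCor t i o a b) → cor-≡ refl (permV-∘ σ σ′ i) (permV-∘ τ τ′ o) }
    ; src = λ c j → inS (lookup (ins c) j)
    ; tgt = λ c k → outS (lookup (outs c) k)
    ; src-act = λ { σ τ (mkCor t i o a b) j → cong inS (lookup∘tabulate _ j) }
    ; tgt-act = λ { σ τ (mkCor t i o a b) k → cong outS (lookup∘tabulate _ k) }
    }

-- Flatness makes every S_m × S_n-orbit of corollas free, so once one corolla is chosen in each
-- orbit (the one of least index, orbits being decidable in a finite set), every corolla is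
-- uniquely a representative acted on by a pair of permutations. The representatives, with their
-- boundary edges read off in order, are the transitions of a Petri net, and the corollas of that
-- net are freely generated by its transitions in the same way; two species freely generated by the
-- same family with matching boundaries are isomorphic. Conversely, the corollas of a Petri net
-- are enumerations of pre- and post-sets: permutations act freely on them, there are finitely
-- many, and injectivity of an enumeration bounds the arities by |I| and |O|.

module Submission where

open import Defs
open import Data.Empty using (⊥-elim)
import Data.Empty.Irrelevant as Irrelevant
open import Data.Fin as Fin using (Fin; zero; suc)
open import Data.Fin.Permutation as Perm using (Permutation; Permutation′; _⟨$⟩ʳ_; _∘ₚ_; _≈_)
open import Data.Fin.Properties using (+↔⊎; any?; all?; injective⇒≤)
  renaming (_≤?_ to _≤ᶠ?_; ≤-antisym to ≤ᶠ-antisym)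
open import Data.Irrelevant using (Irrelevant; [_])
open import Data.Nat using (ℕ; zero; suc; _<_; _+_; _⊔_; z≤n; s≤s; s<s⁻¹; _≤?_)
open import Data.Nat.Properties using (n≮0; ≤-trans; m≤m⊔n; m≤n⊔m)
open import Data.Product using (Σ; ∃; ∃₂; _×_; _,_; proj₁; proj₂)
open import Data.Product.Function.Dependent.Propositional using (Σ-↔)
open import Data.Sum using (_⊎_; inj₁; inj₂)
open import Data.Sum.Function.Propositional using (_⊎-↔_)
open import Data.Vec using (Vec; []; _∷_; lookup; tabulate)
open import Data.Vec.Properties using (lookup∘tabulate; tabulate∘lookup; tabulate-cong)
open import Function using (_∘_)
open import Function.Bundles using (_↔_; _⇔_; Inverse; Injection; mk↔ₛ′; mk⇔)
open import Function.Definitions using (Injective)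
open import Function.Properties.Inverse using (↔-refl; ↔-sym; ↔-trans; ↔⇒↣)
open import Level using (0ℓ)
open import Relation.Binary.Definitions using (DecidableEquality)
open import Relation.Binary.PropositionalEquality
open import Relation.Nullary using (Dec; yes; no)
open import Relation.Nullary.Decidable using (map′; recompute; _×-dec_; _→-dec_)
open import Relation.Unary using (Pred; Decidable)

open Inverse using (to; from; strictlyInverseˡ; strictlyInverseʳ)

to-injective : ∀ {A B : Set} (A↔B : A ↔ B) → Injective _≡_ _≡_ (to A↔B)
to-injective A↔B = Injection.injective (↔⇒↣ A↔B)

finite-↔ : ∀ {A B : Set} → A ↔ B → Finite B → Finite A
finite-↔ A↔B (k , B↔Fin) = k , ↔-trans A↔B B↔Fin

finite-Fin : ∀ k → Finite (Fin k)
finite-Fin k = k , ↔-refl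

finite-⊎ : ∀ {A B : Set} → Finite A → Finite B → Finite (A ⊎ B)
finite-⊎ (a , A↔Fin) (b , B↔Fin) = a + b , ↔-trans (A↔Fin ⊎-↔ B↔Fin) (↔-sym +↔⊎)

Σ-Fin-suc-↔ : ∀ {k} {B : Fin (suc k) → Set} → Σ (Fin (suc k)) B ↔ (B zero ⊎ Σ (Fin k) (B ∘ suc))
Σ-Fin-suc-↔ = mk↔ₛ′
  (λ { (zero , b) → inj₁ b ; (suc i , b) → inj₂ (i , b) })
  (λ { (inj₁ b) → zero , b ; (inj₂ (i , b)) → suc i , b })
  (λ { (inj₁ _) → refl ; (inj₂ _) → refl })
  (λ { (zero , _) → refl ; (suc _ , _) → refl })

finite-Σ-Fin : ∀ k {B : Fin k → Set} → (∀ i → Finite (B i)) → Finite (Σ (Fin k) B)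
finite-Σ-Fin zero    _   = 0 , mk↔ₛ′ (λ ()) (λ ()) (λ ()) (λ ())
finite-Σ-Fin (suc k) fin =
  finite-↔ Σ-Fin-suc-↔ (finite-⊎ (fin zero) (finite-Σ-Fin k (fin ∘ suc)))

finite-Σ : ∀ {A : Set} {B : A → Set} → Finite A → (∀ a → Finite (B a)) → Finite (Σ A B)
finite-Σ (k , A↔Fin) fin =
  finite-↔ (↔-sym (Σ-↔ (↔-sym A↔Fin) ↔-refl)) (finite-Σ-Fin k (fin ∘ from A↔Fin))

finite-× : ∀ {A B : Set} → Finite A → Finite B → Finite (A × B)
finite-× finite-A finite-B = finite-Σ finite-A (λ _ → finite-B)

finite-Vec : ∀ {A : Set} m → Finite A → Finite (Vec A m)
finite-Vec zero    _        = 1 , mk↔ₛ′ (λ _ → zero) (λ _ → []) (λ { zero → refl }) (λ { [] → refl })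
finite-Vec (suc m) finite-A = finite-↔ Vec-suc-↔ (finite-× finite-A (finite-Vec m finite-A))
  where
  Vec-suc-↔ : Vec _ (suc m) ↔ (_ × Vec _ m)
  Vec-suc-↔ = mk↔ₛ′ (λ { (x ∷ xs) → x , xs }) (λ (x , xs) → x ∷ xs)
                    (λ _ → refl) (λ { (_ ∷ _) → refl })

finite-Irrelevant : ∀ {A : Set} → Dec A → Finite (Irrelevant A)
finite-Irrelevant (yes a) = 1 , mk↔ₛ′ (λ _ → zero) (λ _ → [ a ]) (λ { zero → refl }) (λ _ → refl)
finite-Irrelevant (no ¬a) = 0 , mk↔ₛ′ (λ { [ a ] → Irrelevant.⊥-elim (¬a a) }) (λ ()) (λ ())
                                      (λ { [ a ] → Irrelevant.⊥-elim (¬a a) })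

Σℕ-↔ : ∀ {B : ℕ → Set} → Σ ℕ B ↔ (B zero ⊎ Σ ℕ (B ∘ suc))
Σℕ-↔ = mk↔ₛ′
  (λ { (zero , b) → inj₁ b ; (suc m , b) → inj₂ (m , b) })
  (λ { (inj₁ b) → zero , b ; (inj₂ (m , b)) → suc m , b })
  (λ { (inj₁ _) → refl ; (inj₂ _) → refl })
  (λ { (zero , _) → refl ; (suc _ , _) → refl })

finite-Σℕ : ∀ N {B : ℕ → Set} → (∀ m → Finite (B m)) → (∀ m → B m → m < N) → Finite (Σ ℕ B)
finite-Σℕ zero    _   bounded = 0 , mk↔ₛ′ (λ (m , b) → ⊥-elim (n≮0 (bounded m b))) (λ ()) (λ ())
                                          (λ (m , b) → ⊥-elim (n≮0 (bounded m b)))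
finite-Σℕ (suc N) fin bounded = finite-↔ Σℕ-↔
  (finite-⊎ (fin zero) (finite-Σℕ N (fin ∘ suc) (λ m b → s<s⁻¹ (bounded (suc m) b))))

finite⇒≟ : ∀ {A : Set} → Finite A → DecidableEquality A
finite⇒≟ (_ , A↔Fin) x y =
  map′ (to-injective A↔Fin) (cong (to A↔Fin)) (to A↔Fin x Fin.≟ to A↔Fin y)

least : ∀ {k} {P : Pred (Fin k) 0ℓ} → Decidable P → ∀ {i} → P i →
        ∃ λ j → P j × (∀ {i′} → P i′ → j Fin.≤ i′)
least {suc k} P? {i} Pi with P? zero
... | yes P0 = zero , P0 , λ _ → z≤n
least {suc k} P? {zero}  Pi | no ¬P0 = ⊥-elim (¬P0 Pi)
least {suc k} P? {suc i} Pi | no ¬P0 with least (P? ∘ suc) Pi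
... | j , Pj , j-least =
  suc j , Pj , λ { {zero} P0 → ⊥-elim (¬P0 P0) ; {suc i′} Pi′ → s≤s (j-least Pi′) }

Respects≈ : ∀ {m} → Pred (Permutation′ m) 0ℓ → Set
Respects≈ Q = ∀ {π ρ} → π ≈ ρ → Q π → Q ρ

-- A permutation of Fin (suc m) is determined by the image i of zero and a permutation of Fin m.
any-Permutation? : ∀ m {Q : Pred (Permutation′ m) 0ℓ} → Respects≈ Q → Decidable Q → Dec (∃ Q)
any-Permutation? zero    resp Q? = map′ (Perm.id ,_) (λ (π , q) → resp (λ ()) q) (Q? Perm.id)
any-Permutation? (suc m) resp Q? = map′
  (λ (i , π , q) → Perm.insert zero i π , q)
  (λ (π , q) → π ⟨$⟩ʳ zero , Perm.remove zero π , resp (sym ∘ Perm.insert-remove zero π) q)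
  (any? λ i → any-Permutation? m (resp ∘ insert-cong i) (Q? ∘ Perm.insert zero i))
  where
  insert-cong : ∀ i {π ρ : Permutation′ m} → π ≈ ρ → Perm.insert zero i π ≈ Perm.insert zero i ρ
  insert-cong i π≈ρ zero    = refl
  insert-cong i π≈ρ (suc k) = cong (Fin.punchIn i) (π≈ρ k)

injective? : ∀ {a b} (f : Fin a → Fin b) → Dec (Injective _≡_ _≡_ f)
injective? f = map′ (λ inj {x} {y} → inj x y) (λ inj x y → inj)
  (all? λ x → all? λ y → (f x Fin.≟ f y) →-dec (x Fin.≟ y))

isEnum? : ∀ {a k m} (p : Fin a → Fin k) (t : Fin k) (f : Fin m → Fin a) → Dec (IsEnum p t f)
isEnum? p t f = all? (λ j → p (f j) Fin.≟ t) ×-dec injective? f ×-dec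
                all? (λ x → (p x Fin.≟ t) →-dec any? (λ j → f j Fin.≟ x))

IsEnum-unique : ∀ {a k m l} {p : Fin a → Fin k} {t : Fin k} {f : Fin m → Fin a} {g : Fin l → Fin a} →
                IsEnum p t f → IsEnum p t g → Σ (Permutation m l) λ π → ∀ j → f j ≡ g (π ⟨$⟩ʳ j)
IsEnum-unique {m = m} {l = l} {f = f} {g} (f-over , f-inj , f-onto) (g-over , g-inj , g-onto) =
  π , λ j → sym (proj₂ (g-onto (f j) (f-over j)))
  where
  π : Permutation m l
  π = Perm.permutation
    (λ j → proj₁ (g-onto (f j) (f-over j)))
    (λ i → proj₁ (f-onto (g i) (g-over i)))
    (λ i → g-inj (trans (proj₂ (g-onto _ _)) (proj₂ (f-onto _ _))))
    (λ j → f-inj (trans (proj₂ (f-onto _ _)) (proj₂ (g-onto _ _))))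

tabulate-injective : ∀ {A : Set} {k} {f g : Fin k → A} → tabulate f ≡ tabulate g → ∀ j → f j ≡ g j
tabulate-injective {f = f} {g} eq j =
  trans (sym (lookup∘tabulate f j)) (trans (cong (λ v → lookup v j) eq) (lookup∘tabulate g j))

module _ (F : Species) where

  act-flip : ∀ {m n} (σ : Permutation′ m) (τ : Permutation′ n) c →
             act F (Perm.flip σ) (Perm.flip τ) (act F σ τ c) ≡ c
  act-flip σ τ c = begin
    act F (Perm.flip σ) (Perm.flip τ) (act F σ τ c) ≡⟨ act-∘ F σ _ τ _ c ⟨
    act F (Perm.flip σ ∘ₚ σ) (Perm.flip τ ∘ₚ τ) c   ≡⟨ act-cong F (λ _ → Perm.inverseʳ σ)
                                                                  (λ _ → Perm.inverseʳ τ) c ⟩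
    act F Perm.id Perm.id c                         ≡⟨ act-id F c ⟩
    c                                               ∎
    where open ≡-Reasoning

  flat⇒free : Flat F → ∀ {m n} {σ σ′ : Permutation′ m} {τ τ′ : Permutation′ n} c →
              act F σ τ c ≡ act F σ′ τ′ c → σ ≈ σ′ × τ ≈ τ′
  flat⇒free flat {σ = σ} {σ′} {τ} {τ′} c eq = undo σ σ′ (proj₁ fixed) , undo τ τ′ (proj₂ fixed)
    where
    open ≡-Reasoning
    fixed : Perm.flip σ′ ∘ₚ σ ≈ Perm.id × Perm.flip τ′ ∘ₚ τ ≈ Perm.id
    fixed = flat (Perm.flip σ′ ∘ₚ σ) (Perm.flip τ′ ∘ₚ τ) c (begin
      act F (Perm.flip σ′ ∘ₚ σ) (Perm.flip τ′ ∘ₚ τ) c    ≡⟨ act-∘ F σ _ τ _ c ⟩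
      act F (Perm.flip σ′) (Perm.flip τ′) (act F σ τ c)   ≡⟨ cong (act F _ _) eq ⟩
      act F (Perm.flip σ′) (Perm.flip τ′) (act F σ′ τ′ c) ≡⟨ act-flip σ′ τ′ c ⟩
      c                                                   ∎)
    undo : ∀ {k} (π ρ : Permutation′ k) → Perm.flip ρ ∘ₚ π ≈ Perm.id → π ≈ ρ
    undo π ρ fix j = trans (cong (π ⟨$⟩ʳ_) (sym (Perm.inverseˡ ρ))) (fix (ρ ⟨$⟩ʳ j))

Decomposition : (F : Species) {B : ℕ → ℕ → Set} → (∀ {m n} → B m n → C F m n) →
                ∀ {m n} → C F m n → Set
Decomposition F {B} basis {m} {n} c =
  Σ (B m n) λ b → Σ (Permutation′ m) λ σ → Σ (Permutation′ n) λ τ → c ≡ act F σ τ (basis b)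

record FreeBasis (F : Species) (B : ℕ → ℕ → Set) : Set where
  field
    basis     : ∀ {m n} → B m n → C F m n
    decompose : ∀ {m n} (c : C F m n) → Decomposition F basis c
    unique    : ∀ {m n} {b b′ : B m n} {σ σ′ : Permutation′ m} {τ τ′ : Permutation′ n} →
                act F σ τ (basis b) ≡ act F σ′ τ′ (basis b′) → b ≡ b′ × σ ≈ σ′ × τ ≈ τ′

module Transfer {F G : Species} {B : ℕ → ℕ → Set} (bF : FreeBasis F B) (bG : FreeBasis G B) where
  open FreeBasis
  open ≡-Reasoning

  rebuild : ∀ {m n} {c : C F m n} → Decomposition F (basis bF) c → C G m n
  rebuild (b , σ , τ , _) = act G σ τ (basis bG b)

  rebuild-unique : ∀ {m n} {c : C F m n} (d d′ : Decomposition F (basis bF) c) →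
                   rebuild d ≡ rebuild d′
  rebuild-unique (b , σ , τ , c≡) (b′ , σ′ , τ′ , c≡′) with unique bF (trans (sym c≡) c≡′)
  ... | refl , σ≈σ′ , τ≈τ′ = act-cong G σ≈σ′ τ≈τ′ (basis bG b)

  transfer : ∀ {m n} → C F m n → C G m n
  transfer c = rebuild (decompose bF c)

  transfer-basis : ∀ {m n} (b : B m n) σ τ →
                   transfer (act F σ τ (basis bF b)) ≡ act G σ τ (basis bG b)
  transfer-basis b σ τ = rebuild-unique (decompose bF _) (b , σ , τ , refl)

  transfer-act : ∀ {m n} (α : Permutation′ m) (β : Permutation′ n) c →
                 transfer (act F α β c) ≡ act G α β (transfer c)
  transfer-act α β c = let (b , σ , τ , c≡) = decompose bF c in begin
    transfer (act F α β c)               ≡⟨ rebuild-unique (decompose bF _)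
                                                           (b , α ∘ₚ σ , β ∘ₚ τ , moved c≡) ⟩
    act G (α ∘ₚ σ) (β ∘ₚ τ) (basis bG b) ≡⟨ act-∘ G σ α τ β _ ⟩
    act G α β (act G σ τ (basis bG b))   ∎
    where
    moved : ∀ {b σ τ} → c ≡ act F σ τ (basis bF b) →
            act F α β c ≡ act F (α ∘ₚ σ) (β ∘ₚ τ) (basis bF b)
    moved {σ = σ} {τ} c≡ = trans (cong (act F α β) c≡) (sym (act-∘ F σ α τ β _))

  module _ (f : E F → E G) where

    transfer-src : (∀ {m n} (b : B m n) j → src G (basis bG b) j ≡ f (src F (basis bF b) j)) →
                   ∀ {m n} (c : C F m n) j → src G (transfer c) j ≡ f (src F c j)
    transfer-src src-basis c j = let (b , σ , τ , c≡) = decompose bF c in begin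
      src G (act G σ τ (basis bG b)) j     ≡⟨ src-act G σ τ _ j ⟩
      src G (basis bG b) (σ ⟨$⟩ʳ j)        ≡⟨ src-basis b _ ⟩
      f (src F (basis bF b) (σ ⟨$⟩ʳ j))    ≡⟨ cong f (src-act F σ τ _ j) ⟨
      f (src F (act F σ τ (basis bF b)) j) ≡⟨ cong (λ c′ → f (src F c′ j)) c≡ ⟨
      f (src F c j)                        ∎

    transfer-tgt : (∀ {m n} (b : B m n) k → tgt G (basis bG b) k ≡ f (tgt F (basis bF b) k)) →
                   ∀ {m n} (c : C F m n) k → tgt G (transfer c) k ≡ f (tgt F c k)
    transfer-tgt tgt-basis c k = let (b , σ , τ , c≡) = decompose bF c in begin
      tgt G (act G σ τ (basis bG b)) k     ≡⟨ tgt-act G σ τ _ k ⟩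
      tgt G (basis bG b) (τ ⟨$⟩ʳ k)        ≡⟨ tgt-basis b _ ⟩
      f (tgt F (basis bF b) (τ ⟨$⟩ʳ k))    ≡⟨ cong f (tgt-act F σ τ _ k) ⟨
      f (tgt F (act F σ τ (basis bF b)) k) ≡⟨ cong (λ c′ → f (tgt F c′ k)) c≡ ⟨
      f (tgt F c k)                        ∎

transfer-inverse : ∀ {F G B} (bF : FreeBasis F B) (bG : FreeBasis G B) {m n} (c : C F m n) →
                   Transfer.transfer bG bF (Transfer.transfer bF bG c) ≡ c
transfer-inverse bF bG c = let (b , σ , τ , c≡) = FreeBasis.decompose bF c in
  trans (Transfer.transfer-basis bG bF b σ τ) (sym c≡)

freeBases⇒≅ : ∀ {F G B} (e : E F ↔ E G) (bF : FreeBasis F B) (bG : FreeBasis G B) →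
  (∀ {m n} (b : B m n) j → src G (FreeBasis.basis bG b) j ≡ to e (src F (FreeBasis.basis bF b) j)) →
  (∀ {m n} (b : B m n) k → tgt G (FreeBasis.basis bG b) k ≡ to e (tgt F (FreeBasis.basis bF b) k)) →
  F ≅ G
freeBases⇒≅ e bF bG src-basis tgt-basis = record
  { isoE    = e
  ; isoC    = λ m n → mk↔ₛ′ transfer (Transfer.transfer bG bF)
                                (transfer-inverse bG bF) (transfer-inverse bF bG)
  ; nat-act = transfer-act
  ; nat-src = transfer-src (to e) src-basis
  ; nat-tgt = transfer-tgt (to e) tgt-basis
  }
  where open Transfer bF bG

module OrbitBasis (F : Species) (flat : Flat F) (finite-C : ∀ m n → Finite (C F m n)) where

  SameOrbit : ∀ {m n} → C F m n → C F m n → Set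
  SameOrbit c c′ = ∃₂ λ σ τ → act F σ τ c ≡ c′

  sameOrbit-refl : ∀ {m n} (c : C F m n) → SameOrbit c c
  sameOrbit-refl c = Perm.id , Perm.id , act-id F c

  sameOrbit-sym : ∀ {m n} {c c′ : C F m n} → SameOrbit c c′ → SameOrbit c′ c
  sameOrbit-sym {c = c} (σ , τ , c↦c′) =
    Perm.flip σ , Perm.flip τ , trans (cong (act F _ _) (sym c↦c′)) (act-flip F σ τ c)

  sameOrbit-trans : ∀ {m n} {c c′ c″ : C F m n} → SameOrbit c c′ → SameOrbit c′ c″ → SameOrbit c c″
  sameOrbit-trans {c = c} (σ , τ , c↦c′) (σ′ , τ′ , c′↦c″) =
    σ′ ∘ₚ σ , τ′ ∘ₚ τ , trans (act-∘ F σ σ′ τ τ′ c) (trans (cong (act F σ′ τ′) c↦c′) c′↦c″)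

  sameOrbit? : ∀ {m n} (c c′ : C F m n) → Dec (SameOrbit c c′)
  sameOrbit? {m} {n} c c′ =
    any-Permutation? m (λ σ≈ρ (τ , q) → τ , trans (act-cong F (sym ∘ σ≈ρ) (λ _ → refl) c) q) λ σ →
    any-Permutation? n (λ τ≈ρ q → trans (act-cong F (λ _ → refl) (sym ∘ τ≈ρ) c) q) λ τ →
    finite⇒≟ (finite-C m n) (act F σ τ c) c′

  module _ {m n : ℕ} where

    element : Fin (proj₁ (finite-C m n)) → C F m n
    element = from (proj₂ (finite-C m n))

    index : C F m n → Fin (proj₁ (finite-C m n))
    index = to (proj₂ (finite-C m n))

    Canonical : Fin (proj₁ (finite-C m n)) → Set
    Canonical i = ∀ j → SameOrbit (element i) (element j) → i Fin.≤ j

    canonical? : Decidable Canonical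
    canonical? i = all? λ j → sameOrbit? (element i) (element j) →-dec (i ≤ᶠ? j)

  Representative : ℕ → ℕ → Set
  Representative m n = Σ (Fin (proj₁ (finite-C m n))) (Irrelevant ∘ Canonical)

  finite-Representative : ∀ m n → Finite (Representative m n)
  finite-Representative m n = finite-Σ (finite-Fin _) (finite-Irrelevant ∘ canonical?)

  orbitBasis : FreeBasis F Representative
  orbitBasis = record { basis = element ∘ proj₁ ; decompose = decompose ; unique = unique }
    where
    decompose : ∀ {m n} (c : C F m n) → Decomposition F {Representative} (element ∘ proj₁) c
    decompose c with least (sameOrbit? c ∘ element) {index c}
                      (subst (SameOrbit c) (sym (strictlyInverseʳ (proj₂ (finite-C _ _)) c))
                             (sameOrbit-refl c))
    ... | i , c↦i@(σ , τ , _) , i-least =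
      (i , [ (λ j i↦j → i-least (sameOrbit-trans c↦i i↦j)) ]) , Perm.flip σ , Perm.flip τ ,
      sym (proj₂ (proj₂ (sameOrbit-sym c↦i)))

    unique : ∀ {m n} {r r′ : Representative m n} {σ σ′ τ τ′} →
             act F σ τ (element (proj₁ r)) ≡ act F σ′ τ′ (element (proj₁ r′)) →
             r ≡ r′ × σ ≈ σ′ × τ ≈ τ′
    unique {r = i , [ i-canonical ]} {i′ , [ i′-canonical ]} {σ} {σ′} {τ} {τ′} eq
      with ≤ᶠ-antisym (recompute (i ≤ᶠ? i′) (i-canonical i′ i↦i′))
                      (recompute (i′ ≤ᶠ? i) (i′-canonical i (sameOrbit-sym i↦i′)))
      where
      i↦i′ : SameOrbit (element i) (element i′)
      i↦i′ = sameOrbit-trans (σ , τ , eq) (sameOrbit-sym (σ′ , τ′ , refl))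
    ... | refl = refl , flat⇒free F flat _ eq

Cor-≡ : ∀ {N m n} {x y : Cor N m n} →
        Cor.tr x ≡ Cor.tr y → Cor.ins x ≡ Cor.ins y → Cor.outs x ≡ Cor.outs y → x ≡ y
Cor-≡ {x = mkCor _ _ _ _ _} {mkCor _ _ _ _ _} refl refl refl = refl

-- Transitions graded by arity, each with its pre- and post-set listed in order. The underlying
-- Petri net has as inputs (outputs) the pairs of a transition t and a position j < arity t.
record OrderedNet : Set₁ where
  field
    nPlaces    : ℕ
    Transition : ℕ → ℕ → Set
    finite     : Finite (Σ ℕ λ m → Σ ℕ (Transition m))
    pre        : ∀ {m n} → Transition m n → Fin m → Fin nPlaces
    post       : ∀ {m n} → Transition m n → Fin n → Fin nPlaces

module UnorderedNet (O : OrderedNet) where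
  open OrderedNet O

  Transitions : Set
  Transitions = Σ ℕ λ m → Σ ℕ (Transition m)

  nT : ℕ
  nT = proj₁ finite

  T↔Fin : Transitions ↔ Fin nT
  T↔Fin = proj₂ finite

  module Ports (arity : Transitions → ℕ) (label : ∀ t → Fin (arity t) → Fin nPlaces) where

    Port : Set
    Port = Σ Transitions (Fin ∘ arity)

    size : ℕ
    size = proj₁ (finite-Σ finite (finite-Fin ∘ arity))

    P↔Fin : Port ↔ Fin size
    P↔Fin = proj₂ (finite-Σ finite (finite-Fin ∘ arity))

    port : ∀ t → Fin (arity t) → Fin size
    port t j = to P↔Fin (t , j)

    owner : Fin size → Fin nT
    owner = to T↔Fin ∘ proj₁ ∘ from P↔Fin

    portLabel : Fin size → Fin nPlaces
    portLabel x = let (t , j) = from P↔Fin x in label t j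

    portLabel-port : ∀ t j → portLabel (port t j) ≡ label t j
    portLabel-port t j = cong (λ (t , j) → label t j) (strictlyInverseʳ P↔Fin (t , j))

    port-injective : ∀ t → Injective _≡_ _≡_ (port t)
    port-injective t eq with to-injective P↔Fin eq
    ... | refl = refl

    port-enum : ∀ t → IsEnum owner (to T↔Fin t) (port t)
    port-enum t =
      (λ j → cong (to T↔Fin ∘ proj₁) (strictlyInverseʳ P↔Fin (t , j))) ,
      port-injective t ,
      λ x owner≡ → let (j , x≡) = fibre (from P↔Fin x) owner≡ in
                   j , trans (cong (to P↔Fin) (sym x≡)) (strictlyInverseˡ P↔Fin x)
      where
      fibre : (p : Port) → to T↔Fin (proj₁ p) ≡ to T↔Fin t → ∃ λ j → p ≡ (t , j)
      fibre (t′ , j) owner≡ with to-injective T↔Fin owner≡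
      ... | refl = j , refl

    enumeration-permutes-ports : ∀ {m} t (v : Vec (Fin size) m) →
                                 IsEnum owner (to T↔Fin t) (lookup v) →
                                 Σ (Permutation m (arity t)) λ π → v ≡ tabulate (port t ∘ (π ⟨$⟩ʳ_))
    enumeration-permutes-ports t v v-enum = let (π , v≗) = IsEnum-unique v-enum (port-enum t) in
      π , trans (sym (tabulate∘lookup v)) (tabulate-cong v≗)

  module In  = Ports (λ (m , _ , _) → m) (λ (_ , _ , r) → pre r)
  module Out = Ports (λ (_ , n , _) → n) (λ (_ , _ , r) → post r)

  petriNet : PetriNet
  petriNet = record
    { nS = nPlaces ; nI = In.size ; nT = nT ; nO = Out.size
    ; inS = In.portLabel ; inT = In.owner ; outT = Out.owner ; outS = Out.portLabel
    }

  private
    permuted : ∀ {a k m} {p : Fin a → Fin k} {t : Fin k} {f : Fin m → Fin a} →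
               IsEnum p t f → ∀ σ → IsEnum p t (lookup (tabulate (f ∘ (σ ⟨$⟩ʳ_))))
    permuted f-enum σ = IsEnum-ext (λ j → sym (lookup∘tabulate _ j)) (IsEnum-perm σ f-enum)

  standard : ∀ {m n} → Transition m n → Permutation′ m → Permutation′ n → Cor petriNet m n
  standard r σ τ = mkCor (to T↔Fin (_ , _ , r))
    (tabulate (In.port (_ , _ , r) ∘ (σ ⟨$⟩ʳ_))) (tabulate (Out.port (_ , _ , r) ∘ (τ ⟨$⟩ʳ_)))
    (permuted (In.port-enum (_ , _ , r)) σ) (permuted (Out.port-enum (_ , _ , r)) τ)

  act-standard : ∀ {m n} (r : Transition m n) σ τ →
                 act (speciesOf petriNet) σ τ (standard r Perm.id Perm.id) ≡ standard r σ τ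
  act-standard r σ τ = Cor-≡ refl (tabulate-cong (λ j → lookup∘tabulate _ (σ ⟨$⟩ʳ j)))
                                  (tabulate-cong (λ k → lookup∘tabulate _ (τ ⟨$⟩ʳ k)))

  standard-injective : ∀ {m n} {r r′ : Transition m n} {σ σ′ τ τ′} →
                       standard r σ τ ≡ standard r′ σ′ τ′ → r ≡ r′ × σ ≈ σ′ × τ ≈ τ′
  standard-injective eq with to-injective T↔Fin (cong Cor.tr eq)
  ... | refl = refl , In.port-injective _ ∘ tabulate-injective (cong Cor.ins eq)
                    , Out.port-injective _ ∘ tabulate-injective (cong Cor.outs eq)

  standard-form : ∀ {m n m′ n′} (r : Transition m′ n′) (π : Permutation m m′) (ρ : Permutation n n′)
                  {x : Cor petriNet m n} → Cor.tr x ≡ to T↔Fin (m′ , n′ , r) →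
                  Cor.ins x ≡ tabulate (In.port (m′ , n′ , r) ∘ (π ⟨$⟩ʳ_)) →
                  Cor.outs x ≡ tabulate (Out.port (m′ , n′ , r) ∘ (ρ ⟨$⟩ʳ_)) →
                  Σ (Transition m n) λ r → ∃₂ λ σ τ → x ≡ standard r σ τ
  standard-form r π ρ tr≡ ins≡ outs≡ with Perm.↔⇒≡ π | Perm.↔⇒≡ ρ
  ... | refl | refl = r , π , ρ , Cor-≡ tr≡ ins≡ outs≡

  to-standard-form : ∀ {m n} (x : Cor petriNet m n) →
                     Σ (Transition m n) λ r → ∃₂ λ σ τ → x ≡ standard r σ τ
  to-standard-form (mkCor tr ins outs ins-enum outs-enum)
    with from T↔Fin tr | strictlyInverseˡ T↔Fin tr
  ... | t@(_ , _ , r) | refl =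
    let (π , ins≡)  = In.enumeration-permutes-ports t ins (recompute (isEnum? _ _ _) ins-enum)
        (ρ , outs≡) = Out.enumeration-permutes-ports t outs (recompute (isEnum? _ _ _) outs-enum)
    in standard-form r π ρ refl ins≡ outs≡

  netBasis : FreeBasis (speciesOf petriNet) Transition
  FreeBasis.basis netBasis r = standard r Perm.id Perm.id
  FreeBasis.decompose netBasis x = let (r , σ , τ , x≡) = to-standard-form x in
    r , σ , τ , trans x≡ (sym (act-standard r σ τ))
  FreeBasis.unique netBasis {b = r} {r′} {σ} {σ′} {τ} {τ′} eq =
    standard-injective {r = r} {r′} {σ} {σ′} {τ} {τ′}
      (trans (sym (act-standard r σ τ)) (trans eq (act-standard r′ σ′ τ′)))

  src-standard : ∀ {m n} (r : Transition m n) j →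
                 src (speciesOf petriNet) (standard r Perm.id Perm.id) j ≡ pre r j
  src-standard r j = trans (cong In.portLabel (lookup∘tabulate _ j)) (In.portLabel-port _ j)

  tgt-standard : ∀ {m n} (r : Transition m n) k →
                 tgt (speciesOf petriNet) (standard r Perm.id Perm.id) k ≡ post r k
  tgt-standard r k = trans (cong Out.portLabel (lookup∘tabulate _ k)) (Out.portLabel-port _ k)

module OrderedNetOf (F : Species) (flat : Flat F) (finite-values : FiniteValues F)
                    (support : FiniteSupport F) where
  open OrbitBasis F flat (proj₂ finite-values)

  E↔Fin : E F ↔ Fin (proj₁ (proj₁ finite-values))
  E↔Fin = proj₂ (proj₁ finite-values)

  representative-bounded : ∀ {m n} → Representative m n →
                           m < suc (proj₁ support) × n < suc (proj₁ support)
  representative-bounded (i , _) =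
    let (m≤N , n≤N) = proj₂ support _ _ (element i) in s≤s m≤N , s≤s n≤N

  orderedNet : OrderedNet
  orderedNet = record
    { nPlaces    = proj₁ (proj₁ finite-values)
    ; Transition = Representative
    ; finite     = finite-Σℕ (suc (proj₁ support))
                     (λ m → finite-Σℕ (suc (proj₁ support)) (finite-Representative m)
                                       (λ _ r → proj₂ (representative-bounded r)))
                     (λ _ (_ , r) → proj₁ (representative-bounded r))
    ; pre        = λ (i , _) j → to E↔Fin (src F (element i) j)
    ; post       = λ (i , _) k → to E↔Fin (tgt F (element i) k)
    }

  open UnorderedNet orderedNet

  ≅-petriNet : F ≅ speciesOf petriNet
  ≅-petriNet = freeBases⇒≅ E↔Fin orbitBasis netBasis src-standard tgt-standard

module _ (N : PetriNet) where
  open PetriNet N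

  speciesOf-flat : Flat (speciesOf N)
  speciesOf-flat σ τ (mkCor _ ins outs ins-enum outs-enum) eq =
    fixes {π = σ} (proj₁ (proj₂ ins-enum)) (cong Cor.ins eq) ,
    fixes {π = τ} (proj₁ (proj₂ outs-enum)) (cong Cor.outs eq)
    where
    fixes : ∀ {a m} {π : Permutation′ m} {v : Vec (Fin a) m} → .(Injective _≡_ _≡_ (lookup v)) →
            tabulate (lookup v ∘ (π ⟨$⟩ʳ_)) ≡ v → π ≈ Perm.id
    fixes {π = π} {v} v-injective πv≡v j = recompute (π ⟨$⟩ʳ j Fin.≟ j)
      (v-injective (tabulate-injective (trans πv≡v (sym (tabulate∘lookup v))) j))

  speciesOf-finiteValues : FiniteValues (speciesOf N)
  speciesOf-finiteValues = finite-Fin nS , λ m n → finite-↔ Cor↔ (finite-Σ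
    (finite-× (finite-Fin nT)
              (finite-× (finite-Vec m (finite-Fin nI)) (finite-Vec n (finite-Fin nO))))
    λ (t , i , o) → finite-Irrelevant (isEnum? inT t (lookup i) ×-dec isEnum? outT t (lookup o)))
    where
    Cor↔ : ∀ {m n} → Cor N m n ↔ Σ (Fin nT × Vec (Fin nI) m × Vec (Fin nO) n) λ (t , i , o) →
                                    Irrelevant (IsEnum inT t (lookup i) × IsEnum outT t (lookup o))
    Cor↔ = mk↔ₛ′ (λ (mkCor t i o i-enum o-enum) → (t , i , o) , [ (i-enum , o-enum) ])
                 (λ ((t , i , o) , [ enums ]) → mkCor t i o (proj₁ enums) (proj₂ enums))
                 (λ _ → refl) (λ _ → refl)

  speciesOf-finiteSupport : FiniteSupport (speciesOf N)
  speciesOf-finiteSupport = nI ⊔ nO , λ m n (mkCor _ _ _ ins-enum outs-enum) →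
    ≤-trans (recompute (m ≤? nI) (injective⇒≤ (proj₁ (proj₂ ins-enum)))) (m≤m⊔n nI nO) ,
    ≤-trans (recompute (n ≤? nO) (injective⇒≤ (proj₁ (proj₂ outs-enum)))) (m≤n⊔m nI nO)

module _ {F G : Species} (F≅G : F ≅ G) where
  open _≅_ F≅G

  Flat-≅ : Flat G → Flat F
  Flat-≅ flat σ τ c eq =
    flat σ τ (to (isoC _ _) c) (trans (sym (nat-act σ τ c)) (cong (to (isoC _ _)) eq))

  FiniteValues-≅ : FiniteValues G → FiniteValues F
  FiniteValues-≅ (finite-E , finite-C) =
    finite-↔ isoE finite-E , λ m n → finite-↔ (isoC m n) (finite-C m n)

  FiniteSupport-≅ : FiniteSupport G → FiniteSupport F
  FiniteSupport-≅ (N , bounded) = N , λ m n c → bounded m n (to (isoC m n) c)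

proposition5p3 : (F : Species) →
    (∃ λ (N : PetriNet) → F ≅ speciesOf N) ⇔ (Flat F × FiniteValues F × FiniteSupport F)
proposition5p3 F = mk⇔
  (λ (N , F≅N) → Flat-≅ F≅N (speciesOf-flat N) , FiniteValues-≅ F≅N (speciesOf-finiteValues N)
                 , FiniteSupport-≅ F≅N (speciesOf-finiteSupport N))
  (λ (flat , finite-values , support) → let open OrderedNetOf F flat finite-values support in
    UnorderedNet.petriNet orderedNet , ≅-petriNet)
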